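{- Let $P_1$ and $P_2$ be LPODs. Then $P_1$ and $P_2$ are strongly equivalent under the most-preferred answer sets (that is, for every LPOD $P$, the programs $P_1 \cup P$ and $P_2 \cup P$ have the same most-preferred answer sets) if and only if $P_1$ and $P_2$ are logically equivalent in the four-valued logic (that is, they have the same models).
   Context: Let $\Sigma$ be a nonempty, countably infinite set of propositional atoms. Formulas are built from atoms using the binary connectives $\wedge$, $\vee$, $\leftarrow$, $\times$ and the unary connective $\mathit{not}$. Truth values are $V=\{F,F^*,T^*,T\}$ ordered $F<F^*<T^*<T$. An interpretation is a function $I:\Sigma\to V$, extended to formulas by: $I(\mathit{not}\,\phi)=T$ if $I(\phi)\le F^*$ and $F$ otherwise; $I(\phi\leftarrow\psi)=T$ if $I(\phi)\ge I(\psi)$ and $F$ otherwise; $I(\phi_1\wedge\phi_2)=\min\{I(\phi_1),I(\phi_2)\}$; $I(\phi_1\vee\phi_2)=\max\{I(\phi_1),I(\phi_2)\}$; $I(\phi_1\times\phi_2)=I(\phi_2)$ if $I(\phi_1)=F^*$ and $I(\phi_1)$ otherwise (these are associative; a comma in a rule body denotes $\wedge$). An LPOD (logic program with ordered disjunction) is a finite set of rules $C_1\times\cdots\times C_n\leftarrow A_1,\ldots,A_m,\mathit{not}\,B_1,\ldots,\mathit{not}\,B_k$ with $n\ge1$, $m,k\ge0$ and all $C_i,A_j,B_l$ atoms. An interpretation $I$ is a model of an LPOD $P$ if every rule of $P$ evaluates to $T$ under $I$; two LPODs are logically equivalent if they have the same models. Define the relation $\prec$ on truth values by $F\prec F^*$,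 $F\prec T^*$, $F\prec T$, $T^*\prec T$ (and no other pairs), with $v_1\preceq v_2$ iff $v_1\prec v_2$ or $v_1=v_2$. For interpretations $I_1,I_2$ of $P$, $I_1\preceq I_2$ iff $I_1(A)\preceq I_2(A)$ for all atoms $A$ in $P$, and $I_1\prec I_2$ iff $I_1\preceq I_2$ and $I_1\ne I_2$. An interpretation $I$ is solid if $I(A)\ne T^*$ for all atoms $A$ in $P$. An answer set of $P$ is a solid $\preceq$-minimal model of $P$. For answer sets $M_1,M_2$ of $P$, letting $M_i^*$ be the set of atoms with value $F^*$ in $M_i$, write $M_1\sqsubset M_2$ iff $M_1^*\subsetneq M_2^*$. A most-preferred answer set of $P$ is an answer set of $P$ that is minimal with respect to $\sqsubset$ among all answer sets of $P$. -}

module Defs where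

open import Data.Nat using (ℕ; _≤?_)
open import Data.List using (List; []; _∷_; _++_)
open import Data.List.NonEmpty using (List⁺; _∷_)
open import Data.List.Membership.Propositional using (_∈_)
open import Data.List.Relation.Unary.Any using (Any)
open import Data.Product using (_×_; ∃)
open import Data.Sum using (_⊎_)
open import Relation.Nullary using (¬_; yes; no)
open import Relation.Binary.PropositionalEquality using (_≡_; _≢_)

Atom : Set
Atom = ℕ

data V : Set where
  F F* T* T : V

rank : V → ℕ
rank F  = 0
rank F* = 1
rank T* = 2
rank T  = 3

minV : V → V → V
minV v w with rank v ≤? rank w
... | yes _ = v
... | no  _ = w

maxV : V → V → V
maxV v w with rank v ≤? rank w
... | yes _ = w
... | no  _ = v

data Formula : Set where
  atom  : Atom → Formula
  _∧ᶠ_  : Formula → Formula → Formula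
  _∨ᶠ_  : Formula → Formula → Formula
  _←ᶠ_  : Formula → Formula → Formula
  _×ᶠ_  : Formula → Formula → Formula
  notᶠ  : Formula → Formula

Interpretation : Set
Interpretation = Atom → V

notV : V → V
notV F  = T
notV F* = T
notV T* = F
notV T  = F

impV : V → V → V
impV v w with rank w ≤? rank v
... | yes _ = T
... | no  _ = F

odV : V → V → V
odV F* w = w
odV v  w = v

⟦_⟧ : Formula → Interpretation → V
⟦ atom a ⟧ I    = I a
⟦ φ ∧ᶠ ψ ⟧ I    = minV (⟦ φ ⟧ I) (⟦ ψ ⟧ I)
⟦ φ ∨ᶠ ψ ⟧ I    = maxV (⟦ φ ⟧ I) (⟦ ψ ⟧ I)
⟦ φ ←ᶠ ψ ⟧ I    = impV (⟦ φ ⟧ I) (⟦ ψ ⟧ I)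
⟦ φ ×ᶠ ψ ⟧ I    = odV (⟦ φ ⟧ I) (⟦ ψ ⟧ I)
⟦ notᶠ φ ⟧ I    = notV (⟦ φ ⟧ I)

-- A rule  C1 × ... × Cn ← A1,...,Am, not B1,...,not Bk   (n ≥ 1)
record Rule : Set where
  constructor rule
  field
    head : List⁺ Atom
    pos  : List Atom
    neg  : List Atom
open Rule public

-- An LPOD is a finite set of rules (a list; only membership matters).
LPOD : Set
LPOD = List Rule

odChain : Atom → List Atom → Formula
odChain c []       = atom c
odChain c (d ∷ cs) = atom c ×ᶠ odChain d cs

headFormula : List⁺ Atom → Formula
headFormula (c ∷ cs) = odChain c cs

bodyLits : List Atom → List Atom → List Formula
bodyLits []       []       = []
bodyLits []       (b ∷ bs) = notᶠ (atom b) ∷ bodyLits [] bs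
bodyLits (a ∷ as) bs = atom a ∷ bodyLits as bs

conj : Formula → List Formula → Formula
conj φ []       = φ
conj φ (ψ ∷ ψs) = φ ∧ᶠ conj ψ ψs

ruleFormula : Rule → Formula
ruleFormula r with bodyLits (pos r) (neg r)
... | []     = headFormula (head r)
... | ψ ∷ ψs = headFormula (head r) ←ᶠ conj ψ ψs

IsModel : Interpretation → LPOD → Set
IsModel I P = ∀ r → r ∈ P → ⟦ ruleFormula r ⟧ I ≡ T

LogicallyEquivalent : LPOD → LPOD → Set
LogicallyEquivalent P₁ P₂ = ∀ I → (IsModel I P₁ → IsModel I P₂) × (IsModel I P₂ → IsModel I P₁)

AtomOfRule : Atom → Rule → Set
AtomOfRule a r = a ∈ Data.List.NonEmpty.toList (head r) ⊎ (a ∈ pos r ⊎ a ∈ neg r)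
  where import Data.List.NonEmpty

AtomOf : Atom → LPOD → Set
AtomOf a P = Any (AtomOfRule a) P

data _≺V_ : V → V → Set where
  F≺F*  : F ≺V F*
  F≺T*  : F ≺V T*
  F≺T   : F ≺V T
  T*≺T  : T* ≺V T

_⪯V_ : V → V → Set
v ⪯V w = v ≺V w ⊎ v ≡ w

_⪯[_]_ : Interpretation → LPOD → Interpretation → Set
I₁ ⪯[ P ] I₂ = ∀ a → AtomOf a P → I₁ a ⪯V I₂ a

_≺[_]_ : Interpretation → LPOD → Interpretation → Set
I₁ ≺[ P ] I₂ = I₁ ⪯[ P ] I₂ × ∃ λ a → AtomOf a P × I₁ a ≢ I₂ a

Solid : LPOD → Interpretation → Set
Solid P I = ∀ a → AtomOf a P → I a ≢ T*

-- Convention: an interpretation of P is represented by a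
-- total interpretation that is F on atoms not occurring in P.
Canonical : LPOD → Interpretation → Set
Canonical P I = ∀ a → ¬ AtomOf a P → I a ≡ F

AnswerSet : LPOD → Interpretation → Set
AnswerSet P M =
  Canonical P M × IsModel M P × Solid P M ×
  (∀ J → IsModel J P → ¬ (J ≺[ P ] M))

_⊏[_]_ : Interpretation → LPOD → Interpretation → Set
M₁ ⊏[ P ] M₂ =
  (∀ a → AtomOf a P → M₁ a ≡ F* → M₂ a ≡ F*) ×
  ∃ λ a → AtomOf a P × M₂ a ≡ F* × M₁ a ≢ F*

MostPreferred : LPOD → Interpretation → Set
MostPreferred P M = AnswerSet P M × (∀ N → AnswerSet P N → ¬ (N ⊏[ P ] M))

SameMostPreferred : LPOD → LPOD → Set
SameMostPreferred P₁ P₂ =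
  ∀ M → (MostPreferred P₁ M → MostPreferred P₂ M) × (MostPreferred P₂ M → MostPreferred P₁ M)

StronglyEquivalentMP : LPOD → LPOD → Set
StronglyEquivalentMP P₁ P₂ = ∀ P → SameMostPreferred (P₁ ++ P) (P₂ ++ P)

module Submission where

-- Logically equivalent programs have the same models, and from this one gets the same answer
-- sets and most-preferred answer sets; the only subtlety is that an atom occurring in just one
-- of the programs must be F in every answer set, since lowering it to F preserves modelhood.
--
-- Conversely, let P₁ and P₂ be strongly equivalent and I a model of P₁. Add to I a few fresh
-- atoms and a test program that describes I: facts for its T-atoms, the rules a × z and
-- c ← a, not c for its F*-atoms, and a ← b among its T*-atoms. If I has no T*-atoms, then I is
-- a most-preferred answer set of P₁ plus the test program, hence of P₂ plus it, so I ⊨ P₂;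
-- applied to the solidification of I (every T* raised to T) this shows that it models P₂. If
-- some rule of P₂ failed in I, solidification would repair it, which forces a T*-head and a true
-- body; this makes the solidification of I minimal, hence a most-preferred answer set of P₂
-- plus the test program and therefore of P₁ plus it, although I is a smaller model of the latter.

open import Defs
open import Data.Nat using (ℕ; suc; _<_; _<?_; _≟_; s≤s)
open import Data.Nat.Properties using (<-irrefl; <-trans; n<1+n)
open import Data.List using (List; []; _∷_; _++_; map; filter; concatMap; downFrom)
open import Data.List.NonEmpty using (List⁺; _∷_; toList)
open import Data.List.Extrema.Nat using (max; xs≤max)
open import Data.List.Membership.Propositional using (_∈_; lose; find)
open import Data.List.Membership.DecPropositional _≟_ using (_∈?_)
open import Data.List.Membership.Propositional.Properties
  using (∈-++⁺ˡ; ∈-++⁺ʳ; ∈-++⁻; ∈-downFrom⁺; ∈-downFrom⁻; ∈-concatMap⁺; ∈-concatMap⁻; ∈-map∘filter⁺; ∈-map∘filter⁻)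
open import Data.List.Relation.Unary.Any using (Any; here; there; any?)
import Data.List.Relation.Unary.Any as Any
import Data.List.Relation.Unary.Any.Properties as Any
import Data.List.Relation.Unary.All as All
open import Data.Product using (_×_; _,_; proj₁; proj₂; ∃; swap)
open import Data.Sum using (_⊎_; inj₁; inj₂)
open import Data.Empty using (⊥-elim)
open import Function using (_∘_)
open import Relation.Nullary using (¬_; Dec; yes; no)
open import Relation.Nullary.Decidable using (_⊎-dec_; _×-dec_)
open import Relation.Binary.PropositionalEquality using (_≡_; _≢_; refl; sym; trans; cong; cong₂; subst; module ≡-Reasoning)

_≟V_ : (v w : V) → Dec (v ≡ w)
F  ≟V F  = yes refl
F  ≟V F* = no λ ()
F  ≟V T* = no λ ()
F  ≟V T  = no λ ()
F* ≟V F  = no λ ()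
F* ≟V F* = yes refl
F* ≟V T* = no λ ()
F* ≟V T  = no λ ()
T* ≟V F  = no λ ()
T* ≟V F* = no λ ()
T* ≟V T* = yes refl
T* ≟V T  = no λ ()
T  ≟V F  = no λ ()
T  ≟V F* = no λ ()
T  ≟V T* = no λ ()
T  ≟V T  = yes refl

F-⪯ : ∀ v → F ⪯V v
F-⪯ F  = inj₂ refl
F-⪯ F* = inj₁ F≺F*
F-⪯ T* = inj₁ F≺T*
F-⪯ T  = inj₁ F≺T

⪯F⇒≡F : ∀ {v} → v ⪯V F → v ≡ F
⪯F⇒≡F (inj₂ v≡F) = v≡F

minV-identityʳ : ∀ v → minV v T ≡ v
minV-identityʳ F  = refl
minV-identityʳ F* = refl
minV-identityʳ T* = refl
minV-identityʳ T  = refl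

solidify : V → V
solidify T* = T
solidify v  = v

solidifyᴵ : Interpretation → Interpretation
solidifyᴵ I x = solidify (I x)

solidify-idem : ∀ v → solidify (solidify v) ≡ solidify v
solidify-idem F  = refl
solidify-idem F* = refl
solidify-idem T* = refl
solidify-idem T  = refl

solidify-≢T* : ∀ v → solidify v ≢ T*
solidify-≢T* F  ()
solidify-≢T* F* ()
solidify-≢T* T* ()
solidify-≢T* T  ()

solidify-fixes : ∀ {v} → v ≢ T* → solidify v ≡ v
solidify-fixes {F}  _    = refl
solidify-fixes {F*} _    = refl
solidify-fixes {T*} v≢T* = ⊥-elim (v≢T* refl)
solidify-fixes {T}  _    = refl

solidify-F* : ∀ {v} → solidify v ≡ F* → v ≡ F*
solidify-F* {F*} _ = refl
solidify-F* {F}  ()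
solidify-F* {T*} ()
solidify-F* {T}  ()

⪯-solidify : ∀ v → v ⪯V solidify v
⪯-solidify F  = inj₂ refl
⪯-solidify F* = inj₂ refl
⪯-solidify T* = inj₁ T*≺T
⪯-solidify T  = inj₂ refl

solidify-odV : ∀ v w → odV (solidify v) (solidify w) ≡ solidify (odV v w)
solidify-odV F  w = refl
solidify-odV F* w = refl
solidify-odV T* w = refl
solidify-odV T  w = refl

solidify-notV : ∀ v → notV (solidify v) ≡ solidify (notV v)
solidify-notV F  = refl
solidify-notV F* = refl
solidify-notV T* = refl
solidify-notV T  = refl

solidify-minV : ∀ v w → minV (solidify v) (solidify w) ≡ solidify (minV v w)
solidify-minV F  w  = refl
solidify-minV F* F  = refl
solidify-minV F* F* = refl
solidify-minV F* T* = refl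
solidify-minV F* T  = refl
solidify-minV T* F  = refl
solidify-minV T* F* = refl
solidify-minV T* T* = refl
solidify-minV T* T  = refl
solidify-minV T  F  = refl
solidify-minV T  F* = refl
solidify-minV T  T* = refl
solidify-minV T  T  = refl

impV-solidify : ∀ v w → impV v w ≡ T → impV (solidify v) (solidify w) ≡ T
impV-solidify F  F  _ = refl
impV-solidify F* F  _ = refl
impV-solidify F* F* _ = refl
impV-solidify T* F  _ = refl
impV-solidify T* F* _ = refl
impV-solidify T* T* _ = refl
impV-solidify T  F  _ = refl
impV-solidify T  F* _ = refl
impV-solidify T  T* _ = refl
impV-solidify T  T  _ = refl
impV-solidify F  F* ()
impV-solidify F  T* ()
impV-solidify F  T  ()
impV-solidify F* T* ()
impV-solidify F* T  ()
impV-solidify T* T  ()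

bodyValue : List Atom → List Atom → Interpretation → V
bodyValue []       []       I = T
bodyValue []       (b ∷ bs) I = minV (notV (I b)) (bodyValue [] bs I)
bodyValue (a ∷ as) bs       I = minV (I a) (bodyValue as bs I)

headValue : List⁺ Atom → Interpretation → V
headValue h I = ⟦ headFormula h ⟧ I

ruleValue : List Atom → List Atom → V → V → V
ruleValue []      []      h b = h
ruleValue []      (_ ∷ _) h b = impV h b
ruleValue (_ ∷ _) _       h b = impV h b

⟦conj⟧ : ∀ φ ps ns I → ⟦ conj φ (bodyLits ps ns) ⟧ I ≡ minV (⟦ φ ⟧ I) (bodyValue ps ns I)
⟦conj⟧ φ []       []       I = sym (minV-identityʳ _)
⟦conj⟧ φ []       (b ∷ bs) I = cong (minV (⟦ φ ⟧ I)) (⟦conj⟧ (notᶠ (atom b)) [] bs I)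
⟦conj⟧ φ (a ∷ as) bs       I = cong (minV (⟦ φ ⟧ I)) (⟦conj⟧ (atom a) as bs I)

⟦ruleFormula⟧ : ∀ r I →
  ⟦ ruleFormula r ⟧ I ≡ ruleValue (pos r) (neg r) (headValue (head r) I) (bodyValue (pos r) (neg r) I)
⟦ruleFormula⟧ (rule h []       [])       I = refl
⟦ruleFormula⟧ (rule h []       (b ∷ bs)) I = cong (impV (headValue h I)) (⟦conj⟧ (notᶠ (atom b)) [] bs I)
⟦ruleFormula⟧ (rule h (a ∷ as) bs)       I = cong (impV (headValue h I)) (⟦conj⟧ (atom a) as bs I)

odChain-local : ∀ c cs {I J} → (∀ {a} → a ∈ c ∷ cs → I a ≡ J a) → ⟦ odChain c cs ⟧ I ≡ ⟦ odChain c cs ⟧ J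
odChain-local c []       I≡J = I≡J (here refl)
odChain-local c (d ∷ cs) I≡J = cong₂ odV (I≡J (here refl)) (odChain-local d cs (I≡J ∘ there))

bodyValue-local : ∀ ps ns {I J} → (∀ {a} → a ∈ ps → I a ≡ J a) → (∀ {a} → a ∈ ns → I a ≡ J a) →
                  bodyValue ps ns I ≡ bodyValue ps ns J
bodyValue-local []       []       _    _    = refl
bodyValue-local []       (b ∷ bs) I≡Jₚ I≡Jₙ =
  cong₂ minV (cong notV (I≡Jₙ (here refl))) (bodyValue-local [] bs I≡Jₚ (I≡Jₙ ∘ there))
bodyValue-local (a ∷ as) bs       I≡Jₚ I≡Jₙ =
  cong₂ minV (I≡Jₚ (here refl)) (bodyValue-local as bs (I≡Jₚ ∘ there) I≡Jₙ)

ruleFormula-local : ∀ r {I J} → (∀ {a} → AtomOfRule a r → I a ≡ J a) → ⟦ ruleFormula r ⟧ I ≡ ⟦ ruleFormula r ⟧ J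
ruleFormula-local r@(rule (c ∷ cs) ps ns) {I} {J} I≡J = begin
  ⟦ ruleFormula r ⟧ I                                             ≡⟨ ⟦ruleFormula⟧ r I ⟩
  ruleValue ps ns (headValue (c ∷ cs) I) (bodyValue ps ns I)      ≡⟨ cong₂ (ruleValue ps ns) head≡ body≡ ⟩
  ruleValue ps ns (headValue (c ∷ cs) J) (bodyValue ps ns J)      ≡⟨ ⟦ruleFormula⟧ r J ⟨
  ⟦ ruleFormula r ⟧ J                                             ∎
  where
  open ≡-Reasoning
  head≡ : headValue (c ∷ cs) I ≡ headValue (c ∷ cs) J
  head≡ = odChain-local c cs (I≡J ∘ inj₁)
  body≡ : bodyValue ps ns I ≡ bodyValue ps ns J
  body≡ = bodyValue-local ps ns (I≡J ∘ inj₂ ∘ inj₁) (I≡J ∘ inj₂ ∘ inj₂)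

isModel-local : ∀ Q {I J} → (∀ {a} → AtomOf a Q → I a ≡ J a) → IsModel I Q → IsModel J Q
isModel-local Q I≡J I⊨Q r r∈Q = trans (sym (ruleFormula-local r (I≡J ∘ lose r∈Q))) (I⊨Q r r∈Q)

odChain-solidify : ∀ c cs I → ⟦ odChain c cs ⟧ (solidifyᴵ I) ≡ solidify (⟦ odChain c cs ⟧ I)
odChain-solidify c []       I = refl
odChain-solidify c (d ∷ cs) I = trans (cong (odV (solidify (I c))) (odChain-solidify d cs I)) (solidify-odV (I c) _)

headValue-solidify : ∀ h I → headValue h (solidifyᴵ I) ≡ solidify (headValue h I)
headValue-solidify (c ∷ cs) = odChain-solidify c cs

bodyValue-solidify : ∀ ps ns I → bodyValue ps ns (solidifyᴵ I) ≡ solidify (bodyValue ps ns I)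
bodyValue-solidify []       []       I = refl
bodyValue-solidify []       (b ∷ bs) I =
  trans (cong₂ minV (solidify-notV (I b)) (bodyValue-solidify [] bs I)) (solidify-minV (notV (I b)) _)
bodyValue-solidify (a ∷ as) bs       I =
  trans (cong (minV (solidify (I a))) (bodyValue-solidify as bs I)) (solidify-minV (I a) _)

ruleValue-solidify : ∀ ps ns h b → ruleValue ps ns h b ≡ T → ruleValue ps ns (solidify h) (solidify b) ≡ T
ruleValue-solidify []      []      h b h≡T = cong solidify h≡T
ruleValue-solidify []      (_ ∷ _) h b     = impV-solidify h b
ruleValue-solidify (_ ∷ _) _       h b     = impV-solidify h b

ruleFormula-solidify : ∀ r I → ⟦ ruleFormula r ⟧ I ≡ T → ⟦ ruleFormula r ⟧ (solidifyᴵ I) ≡ T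
ruleFormula-solidify r@(rule h ps ns) I r≡T = begin
  ⟦ ruleFormula r ⟧ (solidifyᴵ I)
    ≡⟨ ⟦ruleFormula⟧ r (solidifyᴵ I) ⟩
  ruleValue ps ns (headValue h (solidifyᴵ I)) (bodyValue ps ns (solidifyᴵ I))
    ≡⟨ cong₂ (ruleValue ps ns) (headValue-solidify h I) (bodyValue-solidify ps ns I) ⟩
  ruleValue ps ns (solidify (headValue h I)) (solidify (bodyValue ps ns I))
    ≡⟨ ruleValue-solidify ps ns _ _ (trans (sym (⟦ruleFormula⟧ r I)) r≡T) ⟩
  T ∎
  where open ≡-Reasoning

isModel-solidify : ∀ Q I → IsModel I Q → IsModel (solidifyᴵ I) Q
isModel-solidify Q I I⊨Q r r∈Q = ruleFormula-solidify r I (I⊨Q r r∈Q)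

atomOfRule? : ∀ a r → Dec (AtomOfRule a r)
atomOfRule? a r = (a ∈? toList (head r)) ⊎-dec ((a ∈? pos r) ⊎-dec (a ∈? neg r))

atomOf? : ∀ a Q → Dec (AtomOf a Q)
atomOf? a = any? (atomOfRule? a)

canonical-support : ∀ {Q M a} → Canonical Q M → M a ≢ F → AtomOf a Q
canonical-support {Q} {M} {a} M-canonical Ma≢F with atomOf? a Q
... | yes a∈Q = a∈Q
... | no  a∉Q = ⊥-elim (Ma≢F (M-canonical a a∉Q))

isModel-++ : ∀ {I} Q P → IsModel I Q → IsModel I P → IsModel I (Q ++ P)
isModel-++ Q P I⊨Q I⊨P r r∈Q++P with ∈-++⁻ Q r∈Q++P
... | inj₁ r∈Q = I⊨Q r r∈Q
... | inj₂ r∈P = I⊨P r r∈P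

isModel-++ˡ : ∀ {I} Q P → IsModel I (Q ++ P) → IsModel I Q
isModel-++ˡ Q P I⊨Q++P r r∈Q = I⊨Q++P r (∈-++⁺ˡ r∈Q)

isModel-++ʳ : ∀ {I} Q P → IsModel I (Q ++ P) → IsModel I P
isModel-++ʳ Q P I⊨Q++P r r∈P = I⊨Q++P r (∈-++⁺ʳ Q r∈P)

LogicallyEquivalent-sym : ∀ {P₁ P₂} → LogicallyEquivalent P₁ P₂ → LogicallyEquivalent P₂ P₁
LogicallyEquivalent-sym P₁≈P₂ I = swap (P₁≈P₂ I)

LogicallyEquivalent-++ : ∀ {Q₁ Q₂} P → LogicallyEquivalent Q₁ Q₂ → LogicallyEquivalent (Q₁ ++ P) (Q₂ ++ P)
LogicallyEquivalent-++ {Q₁} {Q₂} P Q₁≈Q₂ I =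
  (λ I⊨ → isModel-++ Q₂ P (proj₁ (Q₁≈Q₂ I) (isModel-++ˡ Q₁ P I⊨)) (isModel-++ʳ Q₁ P I⊨)) ,
  (λ I⊨ → isModel-++ Q₁ P (proj₂ (Q₁≈Q₂ I) (isModel-++ˡ Q₂ P I⊨)) (isModel-++ʳ Q₂ P I⊨))

update : Interpretation → Atom → V → Interpretation
update I a v x with x ≟ a
... | yes _ = v
... | no  _ = I x

update-same : ∀ I a v → update I a v a ≡ v
update-same I a v with a ≟ a
... | yes _   = refl
... | no  a≢a = ⊥-elim (a≢a refl)

update-other : ∀ I a v {x} → x ≢ a → update I a v x ≡ I x
update-other I a v {x} x≢a with x ≟ a
... | yes x≡a = ⊥-elim (x≢a x≡a)
... | no  _   = refl

update-⪯ : ∀ I a {v} → v ⪯V I a → ∀ x → update I a v x ⪯V I x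
update-⪯ I a v⪯Ia x with x ≟ a
... | yes refl = v⪯Ia
... | no  _    = inj₂ refl

⊏-transfer : ∀ {A₁ A₂ M N} → Canonical A₁ M → Canonical A₂ N → N ⊏[ A₂ ] M → N ⊏[ A₁ ] M
⊏-transfer M-canonical N-canonical (N*⊆M* , x , _ , Mx≡F* , Nx≢F*) =
  (λ a _ Na≡F* → N*⊆M* a (canonical-support N-canonical (subst (_≢ F) (sym Na≡F*) λ ())) Na≡F*) ,
  x , canonical-support M-canonical (subst (_≢ F) (sym Mx≡F*) λ ()) , Mx≡F* , Nx≢F*

module _ {A₁ A₂ : LPOD} (A₁≈A₂ : LogicallyEquivalent A₁ A₂) where
  private
    ⊨A₁⇒⊨A₂ : ∀ {I} → IsModel I A₁ → IsModel I A₂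
    ⊨A₁⇒⊨A₂ = proj₁ (A₁≈A₂ _)
    ⊨A₂⇒⊨A₁ : ∀ {I} → IsModel I A₂ → IsModel I A₁
    ⊨A₂⇒⊨A₁ = proj₂ (A₁≈A₂ _)

  -- Otherwise lowering a to F would give a smaller model of A₂, hence of A₁.
  answerSet-vanishes-off : ∀ {M a} → AnswerSet A₁ M → AtomOf a A₁ → ¬ AtomOf a A₂ → M a ≡ F
  answerSet-vanishes-off {M} {a} (_ , M⊨A₁ , _ , minimal) a∈A₁ a∉A₂ with M a ≟V F
  ... | yes Ma≡F = Ma≡F
  ... | no  Ma≢F = ⊥-elim (minimal J J⊨A₁ (J⪯M , a , a∈A₁ , Ja≢Ma))
    where
    J : Interpretation
    J = update M a F
    J⊨A₁ : IsModel J A₁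
    J⊨A₁ = ⊨A₂⇒⊨A₁ (isModel-local A₂ (λ x∈A₂ → sym (update-other M a F (λ { refl → a∉A₂ x∈A₂ })))
                                     (⊨A₁⇒⊨A₂ M⊨A₁))
    J⪯M : J ⪯[ A₁ ] M
    J⪯M x _ = update-⪯ M a (F-⪯ (M a)) x
    Ja≢Ma : J a ≢ M a
    Ja≢Ma Ja≡Ma = Ma≢F (trans (sym Ja≡Ma) (update-same M a F))

  answerSet-transfer : ∀ {M} → AnswerSet A₁ M → AnswerSet A₂ M
  answerSet-transfer {M} M∈AS@(M-canonical , M⊨A₁ , M-solid , minimal) =
    canonical₂ , ⊨A₁⇒⊨A₂ M⊨A₁ , solid₂ , minimal₂
    where
    canonical₂ : Canonical A₂ M
    canonical₂ a a∉A₂ with atomOf? a A₁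
    ... | yes a∈A₁ = answerSet-vanishes-off M∈AS a∈A₁ a∉A₂
    ... | no  a∉A₁ = M-canonical a a∉A₁

    solid₂ : Solid A₂ M
    solid₂ a _ Ma≡T* = M-solid a (canonical-support M-canonical (subst (_≢ F) (sym Ma≡T*) λ ())) Ma≡T*

    minimal₂ : ∀ J → IsModel J A₂ → ¬ (J ≺[ A₂ ] M)
    minimal₂ J J⊨A₂ (J⪯M , x , x∈A₂ , Jx≢Mx) = minimal J′ (⊨A₂⇒⊨A₁ J′⊨A₂) (J′⪯M , x , x∈A₁ , J′x≢Mx)
      where
      J′ : Interpretation
      J′ y with atomOf? y A₂
      ... | yes _ = J y
      ... | no  _ = M y

      J′⊨A₂ : IsModel J′ A₂
      J′⊨A₂ = isModel-local A₂ J≡J′ J⊨A₂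
        where
        J≡J′ : ∀ {a} → AtomOf a A₂ → J a ≡ J′ a
        J≡J′ {a} a∈A₂ with atomOf? a A₂
        ... | yes _   = refl
        ... | no  a∉A₂ = ⊥-elim (a∉A₂ a∈A₂)

      J′⪯M : J′ ⪯[ A₁ ] M
      J′⪯M y _ with atomOf? y A₂
      ... | yes y∈A₂ = J⪯M y y∈A₂
      ... | no  _    = inj₂ refl

      x∈A₁ : AtomOf x A₁
      x∈A₁ = canonical-support M-canonical λ Mx≡F →
        Jx≢Mx (trans (⪯F⇒≡F (subst (J x ⪯V_) Mx≡F (J⪯M x x∈A₂))) (sym Mx≡F))

      J′x≢Mx : J′ x ≢ M x
      J′x≢Mx with atomOf? x A₂
      ... | yes _    = Jx≢Mx
      ... | no  x∉A₂ = ⊥-elim (x∉A₂ x∈A₂)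

mostPreferred-transfer : ∀ {A₁ A₂ M} → LogicallyEquivalent A₁ A₂ → MostPreferred A₁ M → MostPreferred A₂ M
mostPreferred-transfer A₁≈A₂ (M∈AS₁ , M-preferred) =
  answerSet-transfer A₁≈A₂ M∈AS₁ ,
  λ N N∈AS₂ N⊏M → M-preferred N (answerSet-transfer (LogicallyEquivalent-sym A₁≈A₂) N∈AS₂)
                                  (⊏-transfer (proj₁ M∈AS₁) (proj₁ N∈AS₂) N⊏M)

logicallyEquivalent⇒stronglyEquivalent : ∀ {P₁ P₂} → LogicallyEquivalent P₁ P₂ → StronglyEquivalentMP P₁ P₂
logicallyEquivalent⇒stronglyEquivalent {P₁} {P₂} P₁≈P₂ P M =
  mostPreferred-transfer P₁++P≈P₂++P , mostPreferred-transfer (LogicallyEquivalent-sym P₁++P≈P₂++P)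
  where
  P₁++P≈P₂++P : LogicallyEquivalent (P₁ ++ P) (P₂ ++ P)
  P₁++P≈P₂++P = LogicallyEquivalent-++ P P₁≈P₂

odChain-attained : ∀ c cs I → ∃ λ a → a ∈ c ∷ cs × ⟦ odChain c cs ⟧ I ≡ I a
odChain-attained c []       I = c , here refl , refl
odChain-attained c (d ∷ cs) I with I c in Ic≡
... | F  = c , here refl , sym Ic≡
... | T* = c , here refl , sym Ic≡
... | T  = c , here refl , sym Ic≡
... | F* with odChain-attained d cs I
...   | a , a∈ , value≡ = a , there a∈ , value≡

headValue-attained : ∀ h I → ∃ λ a → a ∈ toList h × headValue h I ≡ I a
headValue-attained (c ∷ cs) = odChain-attained c cs

minV-T : ∀ {v w} → minV v w ≡ T → v ≡ T × w ≡ T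
minV-T {T} {T} _ = refl , refl
minV-T {F}  {F} ()
minV-T {F}  {F*} ()
minV-T {F}  {T*} ()
minV-T {F}  {T} ()
minV-T {F*} {F} ()
minV-T {F*} {F*} ()
minV-T {F*} {T*} ()
minV-T {F*} {T} ()
minV-T {T*} {F} ()
minV-T {T*} {F*} ()
minV-T {T*} {T*} ()
minV-T {T*} {T} ()
minV-T {T}  {F} ()
minV-T {T}  {F*} ()
minV-T {T}  {T*} ()

notV-T : ∀ {v} → notV v ≡ T → v ≢ T*
notV-T {T*} ()
notV-T {F}  _ ()
notV-T {F*} _ ()
notV-T {T}  ()

bodyValue-T : ∀ ps ns I → bodyValue ps ns I ≡ T →
              (∀ {a} → a ∈ ps → I a ≢ T*) × (∀ {a} → a ∈ ns → I a ≢ T*)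
bodyValue-T []       []       I _ = (λ ()) , (λ ())
bodyValue-T []       (b ∷ bs) I body≡T with minV-T {notV (I b)} body≡T
... | notIb≡T , rest≡T = (λ ()) , λ { (here refl) → notV-T notIb≡T ; (there a∈) → proj₂ (bodyValue-T [] bs I rest≡T) a∈ }
bodyValue-T (a ∷ as) bs       I body≡T with minV-T {I a} body≡T
... | Ia≡T , rest≡T =
  (λ { (here refl) → subst (_≢ T*) (sym Ia≡T) λ () ; (there x∈) → proj₁ (bodyValue-T as bs I rest≡T) x∈ }) ,
  proj₂ (bodyValue-T as bs I rest≡T)

impV-solidify-jump : ∀ h b → impV h b ≢ T → impV (solidify h) (solidify b) ≡ T → h ≡ T* × b ≡ T
impV-solidify-jump T* T  _ _ = refl , refl
impV-solidify-jump F  F  fails _ = ⊥-elim (fails refl)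
impV-solidify-jump F* F  fails _ = ⊥-elim (fails refl)
impV-solidify-jump F* F* fails _ = ⊥-elim (fails refl)
impV-solidify-jump T* F  fails _ = ⊥-elim (fails refl)
impV-solidify-jump T* F* fails _ = ⊥-elim (fails refl)
impV-solidify-jump T* T* fails _ = ⊥-elim (fails refl)
impV-solidify-jump T  F  fails _ = ⊥-elim (fails refl)
impV-solidify-jump T  F* fails _ = ⊥-elim (fails refl)
impV-solidify-jump T  T* fails _ = ⊥-elim (fails refl)
impV-solidify-jump T  T  fails _ = ⊥-elim (fails refl)
impV-solidify-jump F  F* _ ()
impV-solidify-jump F  T* _ ()
impV-solidify-jump F  T  _ ()
impV-solidify-jump F* T* _ ()
impV-solidify-jump F* T  _ ()

solidify-jump : ∀ v → v ≢ T → solidify v ≡ T → v ≡ T*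
solidify-jump T* _     _ = refl
solidify-jump T  v≢T   _ = ⊥-elim (v≢T refl)
solidify-jump F  _    ()
solidify-jump F* _    ()

ruleValue-solidify-jump : ∀ ps ns h I → let b = bodyValue ps ns I in
                          ruleValue ps ns h b ≢ T → ruleValue ps ns (solidify h) (solidify b) ≡ T → h ≡ T* × b ≡ T
ruleValue-solidify-jump []      []      h I fails holds = solidify-jump h fails holds , refl
ruleValue-solidify-jump []      (_ ∷ _) h I             = impV-solidify-jump h _
ruleValue-solidify-jump (_ ∷ _) _       h I             = impV-solidify-jump h _

rule-repaired-by-solidify : ∀ r I → ⟦ ruleFormula r ⟧ I ≢ T → ⟦ ruleFormula r ⟧ (solidifyᴵ I) ≡ T →
                            headValue (head r) I ≡ T* × bodyValue (pos r) (neg r) I ≡ T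
rule-repaired-by-solidify r@(rule h ps ns) I fails holds =
  ruleValue-solidify-jump ps ns (headValue h I) I
    (fails ∘ trans (⟦ruleFormula⟧ r I))
    (begin
      ruleValue ps ns (solidify (headValue h I)) (solidify (bodyValue ps ns I))
        ≡⟨ cong₂ (ruleValue ps ns) (headValue-solidify h I) (bodyValue-solidify ps ns I) ⟨
      ruleValue ps ns (headValue h (solidifyᴵ I)) (bodyValue ps ns (solidifyᴵ I))
        ≡⟨ ⟦ruleFormula⟧ r (solidifyᴵ I) ⟨
      ⟦ ruleFormula r ⟧ (solidifyᴵ I)
        ≡⟨ holds ⟩
      T ∎)
  where open ≡-Reasoning

T*-head-of-repaired-rule : ∀ r I → ⟦ ruleFormula r ⟧ I ≢ T → ⟦ ruleFormula r ⟧ (solidifyᴵ I) ≡ T →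
                           ∃ λ x → x ∈ toList (head r) × I x ≡ T*
T*-head-of-repaired-rule r I fails holds with headValue-attained (head r) I
... | x , x∈head , head≡Ix = x , x∈head , trans (sym head≡Ix) (proj₁ (rule-repaired-by-solidify r I fails holds))

data Lowered : V → V → Set where
  same : ∀ {v} → Lowered v v
  T*↦F : Lowered T* F

Lowered-fixes : ∀ {v w} → Lowered v w → v ≢ T* → w ≡ v
Lowered-fixes same _    = refl
Lowered-fixes T*↦F v≢T* = ⊥-elim (v≢T* refl)

T*-Lowered : ∀ {w} → w ⪯V T → w ≢ T → Lowered T* w
T*-Lowered {F}  _ _   = T*↦F
T*-Lowered {T*} _ _   = same
T*-Lowered {T}  _ w≢T = ⊥-elim (w≢T refl)
T*-Lowered {F*} (inj₁ ())
T*-Lowered {F*} (inj₂ ())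

odV-Lowered : ∀ {v v′ w w′} → Lowered v v′ → Lowered w w′ → Lowered (odV v w) (odV v′ w′)
odV-Lowered {F}  same _  = same
odV-Lowered {F*} same w↓ = w↓
odV-Lowered {T*} same _  = same
odV-Lowered {T}  same _  = same
odV-Lowered T*↦F _       = T*↦F

odChain-Lowered : ∀ c cs {I J} → (∀ {a} → a ∈ c ∷ cs → Lowered (I a) (J a)) →
                  Lowered (⟦ odChain c cs ⟧ I) (⟦ odChain c cs ⟧ J)
odChain-Lowered c []       I↓J = I↓J (here refl)
odChain-Lowered c (d ∷ cs) I↓J = odV-Lowered (I↓J (here refl)) (odChain-Lowered d cs (I↓J ∘ there))

lowered-head-fails : ∀ ps ns {h} → Lowered T* h → ruleValue ps ns h T ≢ T
lowered-head-fails []      []      same ()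
lowered-head-fails []      []      T*↦F ()
lowered-head-fails []      (_ ∷ _) same ()
lowered-head-fails []      (_ ∷ _) T*↦F ()
lowered-head-fails (_ ∷ _) _       same ()
lowered-head-fails (_ ∷ _) _       T*↦F ()

rule-fails-when-lowered : ∀ r {I J} → ⟦ ruleFormula r ⟧ I ≢ T → ⟦ ruleFormula r ⟧ (solidifyᴵ I) ≡ T →
                          (∀ {a} → AtomOfRule a r → Lowered (I a) (J a)) → ⟦ ruleFormula r ⟧ J ≢ T
rule-fails-when-lowered r@(rule (c ∷ cs) ps ns) {I} {J} fails holds I↓J J⊨r =
  lowered-head-fails ps ns head↓ (subst (λ b → ruleValue ps ns _ b ≡ T) body≡T (trans (sym (⟦ruleFormula⟧ r J)) J⊨r))
  where
  repaired : headValue (c ∷ cs) I ≡ T* × bodyValue ps ns I ≡ T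
  repaired = rule-repaired-by-solidify r I fails holds
  body-solid : (∀ {a} → a ∈ ps → I a ≢ T*) × (∀ {a} → a ∈ ns → I a ≢ T*)
  body-solid = bodyValue-T ps ns I (proj₂ repaired)
  head↓ : Lowered T* (headValue (c ∷ cs) J)
  head↓ = subst (λ v → Lowered v _) (proj₁ repaired) (odChain-Lowered c cs (I↓J ∘ inj₁))
  body≡T : bodyValue ps ns J ≡ T
  body≡T = trans (bodyValue-local ps ns (λ a∈ → Lowered-fixes (I↓J (inj₂ (inj₁ a∈))) (proj₁ body-solid a∈))
                                        (λ a∈ → Lowered-fixes (I↓J (inj₂ (inj₂ a∈))) (proj₂ body-solid a∈)))
                 (proj₂ repaired)

impV-T⇒T : ∀ {w} → impV w T ≡ T → w ≡ T
impV-T⇒T {T}  _ = refl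
impV-T⇒T {F}  ()
impV-T⇒T {F*} ()
impV-T⇒T {T*} ()

choice-holds : ∀ {v} → odV v T ≡ T → v ≡ F* ⊎ v ≡ T
choice-holds {F*} _ = inj₁ refl
choice-holds {T}  _ = inj₂ refl
choice-holds {F}  ()
choice-holds {T*} ()

choice-holds-⪯F* : ∀ {v} → odV v T ≡ T → v ⪯V F* → v ≡ F*
choice-holds-⪯F* {F*} _ _        = refl
choice-holds-⪯F* {F}  ()
choice-holds-⪯F* {T*} ()
choice-holds-⪯F* {T}  _ (inj₁ ())
choice-holds-⪯F* {T}  _ (inj₂ ())

constraint-holds-F* : ∀ {w} → impV w (minV F* (notV w)) ≡ T → w ≢ T* → w ≢ T → w ≡ F*
constraint-holds-F* {F*} _ _ _    = refl
constraint-holds-F* {F}  ()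
constraint-holds-F* {T*} _ w≢T* _ = ⊥-elim (w≢T* refl)
constraint-holds-F* {T}  _ _ w≢T  = ⊥-elim (w≢T refl)

constraint-holds-⪯F* : ∀ {w} → impV w (minV F* (notV w)) ≡ T → w ⪯V F* → w ≡ F*
constraint-holds-⪯F* {F*} _ _ = refl
constraint-holds-⪯F* {F}  ()
constraint-holds-⪯F* {T*} _ (inj₁ ())
constraint-holds-⪯F* {T*} _ (inj₂ ())
constraint-holds-⪯F* {T}  _ (inj₁ ())
constraint-holds-⪯F* {T}  _ (inj₂ ())

constraint-holds-T : ∀ {w} → impV w (minV T (notV w)) ≡ T → w ≢ T* → w ≡ T
constraint-holds-T {T}  _ _    = refl
constraint-holds-T {F}  ()
constraint-holds-T {F*} ()
constraint-holds-T {T*} _ w≢T* = ⊥-elim (w≢T* refl)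

constraint-holds-T* : ∀ v → impV T* (minV v (notV T*)) ≡ T
constraint-holds-T* F  = refl
constraint-holds-T* F* = refl
constraint-holds-T* T* = refl
constraint-holds-T* T  = refl

-- The relevant atoms of I lie below z; the fresh atoms are z (a fact), c and e, and I⁺ extends
-- I by T, F*, F* on them. The ordered disjunction a × z only allows a to be F* or T, and the
-- constraint c ← a, not c excludes T as long as c is solid; e forces c to F*. The rules a ⇐ b
-- among the T*-atoms make raising one of them to T raise all of them.
module TestProgram (I : Interpretation) (z : ℕ) where

  c e : Atom
  c = suc z
  e = suc (suc z)

  I⁺ : Interpretation
  I⁺ x with x <? z
  ... | yes _ = I x
  ... | no  _ with x ≟ z
  ... | yes _ = T
  ... | no  _ with x ≟ c
  ... | yes _ = F*
  ... | no  _ with x ≟ e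
  ... | yes _ = F*
  ... | no  _ = F

  data Position (x : Atom) : V → Set where
    below  : x < z → Position x (I x)
    at-z   : x ≡ z → Position x T
    at-c   : x ≡ c → Position x F*
    at-e   : x ≡ e → Position x F*
    beyond : Position x F

  position : ∀ x → Position x (I⁺ x)
  position x with x <? z
  ... | yes x<z = below x<z
  ... | no  _ with x ≟ z
  ... | yes x≡z = at-z x≡z
  ... | no  _ with x ≟ c
  ... | yes x≡c = at-c x≡c
  ... | no  _ with x ≟ e
  ... | yes x≡e = at-e x≡e
  ... | no  _   = beyond

  I⁺-below : ∀ {x} → x < z → I⁺ x ≡ I x
  I⁺-below {x} x<z with x <? z
  ... | yes _   = refl
  ... | no  x≮z = ⊥-elim (x≮z x<z)

  I⁺-z : I⁺ z ≡ T
  I⁺-z with z <? z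
  ... | yes z<z = ⊥-elim (<-irrefl refl z<z)
  ... | no  _ with z ≟ z
  ... | yes _   = refl
  ... | no  z≢z = ⊥-elim (z≢z refl)

  I⁺-c : I⁺ c ≡ F*
  I⁺-c with c <? z
  ... | yes c<z = ⊥-elim (<-irrefl refl (<-trans (n<1+n z) c<z))
  ... | no  _ with c ≟ z
  ... | yes c≡z = ⊥-elim (<-irrefl (sym c≡z) (n<1+n z))
  ... | no  _ with c ≟ c
  ... | yes _   = refl
  ... | no  c≢c = ⊥-elim (c≢c refl)

  I⁺-e : I⁺ e ≡ F*
  I⁺-e with e <? z
  ... | yes e<z = ⊥-elim (<-irrefl refl (<-trans (<-trans (n<1+n z) (n<1+n c)) e<z))
  ... | no  _ with e ≟ z
  ... | yes e≡z = ⊥-elim (<-irrefl (sym e≡z) (<-trans (n<1+n z) (n<1+n c)))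
  ... | no  _ with e ≟ c
  ... | yes e≡c = ⊥-elim (<-irrefl (sym e≡c) (n<1+n c))
  ... | no  _ with e ≟ e
  ... | yes _   = refl
  ... | no  e≢e = ⊥-elim (e≢e refl)

  T*-below : ∀ {x} → I⁺ x ≡ T* → x < z
  T*-below {x} = T*-position (position x)
    where
    T*-position : ∀ {x v} → Position x v → v ≡ T* → x < z
    T*-position (below x<z) _ = x<z
    T*-position (at-z _) ()
    T*-position (at-c _) ()
    T*-position (at-e _) ()
    T*-position beyond   ()

  M : Interpretation
  M = solidifyᴵ I⁺

  fact : Atom → Rule
  fact a = rule (a ∷ []) [] []

  _⇐_ : Atom → Atom → Rule
  a ⇐ b = rule (a ∷ []) (b ∷ []) []

  choice : Atom → Rule
  choice a = rule (a ∷ z ∷ []) [] []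

  constraint : Atom → Rule
  constraint a = rule (c ∷ []) (a ∷ []) (c ∷ [])

  rulesFor : Atom → V → List Rule
  rulesFor a T  = fact a ∷ []
  rulesFor a T* = map (a ⇐_) (filter (λ b → I⁺ b ≟V T*) (downFrom z))
  rulesFor a F* = choice a ∷ constraint a ∷ []
  rulesFor a F  = []

  described : List Atom
  described = e ∷ downFrom z

  testProgram : LPOD
  testProgram = fact z ∷ concatMap (λ a → rulesFor a (I⁺ a)) described

  data TestRule : Rule → Set where
    fact-z        : TestRule (fact z)
    fact-T        : ∀ {a} → a ∈ described → I⁺ a ≡ T → TestRule (fact a)
    ⇐-T*          : ∀ {a b} → a ∈ described → I⁺ a ≡ T* → b < z → I⁺ b ≡ T* → TestRule (a ⇐ b)
    choice-F*     : ∀ {a} → a ∈ described → I⁺ a ≡ F* → TestRule (choice a)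
    constraint-F* : ∀ {a} → a ∈ described → I⁺ a ≡ F* → TestRule (constraint a)

  ∈-rulesFor : ∀ {a r v} → a ∈ described → I⁺ a ≡ v → r ∈ rulesFor a v → r ∈ testProgram
  ∈-rulesFor a∈ refl r∈ = there (∈-concatMap⁺ (λ a → rulesFor a (I⁺ a)) (lose a∈ r∈))

  testRule⇒∈ : ∀ {r} → TestRule r → r ∈ testProgram
  testRule⇒∈ fact-z                                  = here refl
  testRule⇒∈ (fact-T a∈ I⁺a≡T)                       = ∈-rulesFor a∈ I⁺a≡T (here refl)
  testRule⇒∈ (⇐-T* {a} {b} a∈ I⁺a≡T* b<z I⁺b≡T*)   = ∈-rulesFor a∈ I⁺a≡T*
    (∈-map∘filter⁺ (a ⇐_) (λ b → I⁺ b ≟V T*) (b , ∈-downFrom⁺ b<z , refl , I⁺b≡T*))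
  testRule⇒∈ (choice-F* a∈ I⁺a≡F*)                   = ∈-rulesFor a∈ I⁺a≡F* (here refl)
  testRule⇒∈ (constraint-F* a∈ I⁺a≡F*)               = ∈-rulesFor a∈ I⁺a≡F* (there (here refl))

  rulesFor⇒testRule : ∀ {a r} v → a ∈ described → I⁺ a ≡ v → r ∈ rulesFor a v → TestRule r
  rulesFor⇒testRule T  a∈ I⁺a≡T (here refl)           = fact-T a∈ I⁺a≡T
  rulesFor⇒testRule {a} T* a∈ I⁺a≡T* r∈
    with b , b∈ , refl , I⁺b≡T* ← ∈-map∘filter⁻ (a ⇐_) (λ b → I⁺ b ≟V T*) {xs = downFrom z} r∈
                                                      = ⇐-T* a∈ I⁺a≡T* (∈-downFrom⁻ b∈) I⁺b≡T*
  rulesFor⇒testRule F* a∈ I⁺a≡F* (here refl)          = choice-F* a∈ I⁺a≡F*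
  rulesFor⇒testRule F* a∈ I⁺a≡F* (there (here refl))  = constraint-F* a∈ I⁺a≡F*

  ∈⇒testRule : ∀ {r} → r ∈ testProgram → TestRule r
  ∈⇒testRule (here refl) = fact-z
  ∈⇒testRule (there r∈)
    with a , a∈ , r∈rulesFor ← find (∈-concatMap⁻ (λ a → rulesFor a (I⁺ a)) r∈) =
    rulesFor⇒testRule (I⁺ a) a∈ refl r∈rulesFor

  module ModelOfTestProgram (J : Interpretation) (J⊨ : IsModel J testProgram) where
    value-z : J z ≡ T
    value-z = J⊨ _ (testRule⇒∈ fact-z)

    value-fact : ∀ {a} → a ∈ described → I⁺ a ≡ T → J a ≡ T
    value-fact a∈ I⁺a≡T = J⊨ _ (testRule⇒∈ (fact-T a∈ I⁺a≡T))

    ⇐-satisfied : ∀ {a b} → a ∈ described → I⁺ a ≡ T* → b < z → I⁺ b ≡ T* → impV (J a) (J b) ≡ T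
    ⇐-satisfied a∈ I⁺a≡T* b<z I⁺b≡T* = J⊨ _ (testRule⇒∈ (⇐-T* a∈ I⁺a≡T* b<z I⁺b≡T*))

    choice-satisfied : ∀ {a} → a ∈ described → I⁺ a ≡ F* → odV (J a) T ≡ T
    choice-satisfied {a} a∈ I⁺a≡F* = subst (λ v → odV (J a) v ≡ T) value-z (J⊨ _ (testRule⇒∈ (choice-F* a∈ I⁺a≡F*)))

    constraint-satisfied : ∀ {a} → a ∈ described → I⁺ a ≡ F* → impV (J c) (minV (J a) (notV (J c))) ≡ T
    constraint-satisfied a∈ I⁺a≡F* = J⊨ _ (testRule⇒∈ (constraint-F* a∈ I⁺a≡F*))

  I⁺⊨testProgram : IsModel I⁺ testProgram
  I⁺⊨testProgram r r∈ with ∈⇒testRule r∈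
  ... | fact-z                                            = I⁺-z
  ... | fact-T _ I⁺a≡T                                    = I⁺a≡T
  ... | ⇐-T* _ I⁺a≡T* _ I⁺b≡T* rewrite I⁺a≡T* | I⁺b≡T*  = refl
  ... | choice-F* _ I⁺a≡F*     rewrite I⁺a≡F* | I⁺-z     = refl
  ... | constraint-F* _ I⁺a≡F* rewrite I⁺a≡F* | I⁺-c     = refl

  M⊨testProgram : IsModel M testProgram
  M⊨testProgram = isModel-solidify testProgram I⁺ I⁺⊨testProgram

  head-atom : ∀ {r x} → TestRule r → x ∈ toList (head r) → AtomOf x testProgram
  head-atom r x∈ = lose (testRule⇒∈ r) (inj₁ x∈)

  testProgram-atom : ∀ {x} → I⁺ x ≢ F → AtomOf x testProgram
  testProgram-atom {x} = atom-at (position x) refl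
    where
    atom-below : ∀ {x} v → x < z → I⁺ x ≡ v → v ≢ F → AtomOf x testProgram
    atom-below T  x<z I⁺x≡T  _   = head-atom (fact-T (there (∈-downFrom⁺ x<z)) I⁺x≡T) (here refl)
    atom-below T* x<z I⁺x≡T* _   = head-atom (⇐-T* (there (∈-downFrom⁺ x<z)) I⁺x≡T* x<z I⁺x≡T*) (here refl)
    atom-below F* x<z I⁺x≡F* _   = head-atom (choice-F* (there (∈-downFrom⁺ x<z)) I⁺x≡F*) (here refl)
    atom-below F  _   _      F≢F = ⊥-elim (F≢F refl)

    atom-at : ∀ {x v} → Position x v → I⁺ x ≡ v → v ≢ F → AtomOf x testProgram
    atom-at (below x<z) I⁺x≡Ix Ix≢F = atom-below _ x<z I⁺x≡Ix Ix≢F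
    atom-at (at-z refl) _ _        = head-atom fact-z (here refl)
    atom-at (at-c refl) _ _        = head-atom (constraint-F* (here refl) I⁺-e) (here refl)
    atom-at (at-e refl) _ _        = head-atom (choice-F* (here refl) I⁺-e) (here refl)
    atom-at beyond      _ F≢F      = ⊥-elim (F≢F refl)

  z≢c : z ≢ c
  z≢c z≡c = <-irrefl z≡c (n<1+n z)

  below-≢c : ∀ {x} → x < z → x ≢ c
  below-≢c x<z refl = <-irrefl refl (<-trans (n<1+n z) x<z)

  described-≢c : ∀ {x} → x ∈ described → x ≢ c
  described-≢c (here refl) e≡c = <-irrefl (sym e≡c) (n<1+n c)
  described-≢c (there x∈) = below-≢c (∈-downFrom⁻ x∈)

  module Extension (Q : LPOD) (Q<z : ∀ {a} → AtomOf a Q → a < z) where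

    A : LPOD
    A = Q ++ testProgram

    A-atom : ∀ {x} → I⁺ x ≢ F → AtomOf x A
    A-atom = Any.++⁺ʳ Q ∘ testProgram-atom

    c∈A : AtomOf c A
    c∈A = A-atom (subst (_≢ F) (sym I⁺-c) λ ())

    M-canonical : Canonical A M
    M-canonical x x∉A with I⁺ x ≟V F
    ... | yes I⁺x≡F = cong solidify I⁺x≡F
    ... | no  I⁺x≢F = ⊥-elim (x∉A (A-atom I⁺x≢F))

    M-solid : Solid A M
    M-solid x _ = solidify-≢T* (I⁺ x)

    module Below (J : Interpretation) (J⊨ : IsModel J testProgram) (J⪯M : J ⪯[ A ] M) where
      open ModelOfTestProgram J J⊨

      J⪯solidify : ∀ {x v} → AtomOf x A → I⁺ x ≡ v → J x ⪯V solidify v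
      J⪯solidify {x} x∈A I⁺x≡v = subst (λ v → J x ⪯V solidify v) I⁺x≡v (J⪯M x x∈A)

      J-F* : ∀ {a} → a ∈ described → I⁺ a ≡ F* → J a ≡ F*
      J-F* a∈ I⁺a≡F* =
        choice-holds-⪯F* (choice-satisfied a∈ I⁺a≡F*) (J⪯solidify (A-atom (subst (_≢ F) (sym I⁺a≡F*) λ ())) I⁺a≡F*)

      J-c : J c ≡ F*
      J-c = constraint-holds-⪯F* e-constraint (J⪯solidify c∈A I⁺-c)
        where
        e-constraint : impV (J c) (minV F* (notV (J c))) ≡ T
        e-constraint = subst (λ v → impV (J c) (minV v (notV (J c))) ≡ T) (J-F* (here refl) I⁺-e)
                             (constraint-satisfied (here refl) I⁺-e)

      agree-described : ∀ {x} v → x ∈ described → I⁺ x ≡ v → AtomOf x A → v ≢ T* → J x ≡ solidify v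
      agree-described T  x∈ I⁺x≡T  _   _     = value-fact x∈ I⁺x≡T
      agree-described F* x∈ I⁺x≡F* _   _     = J-F* x∈ I⁺x≡F*
      agree-described F  _  I⁺x≡F  x∈A _     = ⪯F⇒≡F (J⪯solidify x∈A I⁺x≡F)
      agree-described T* _  _      _   T*≢T* = ⊥-elim (T*≢T* refl)

      agree-at : ∀ {x v} → Position x v → I⁺ x ≡ v → AtomOf x A → v ≢ T* → J x ≡ solidify v
      agree-at (below x<z) = agree-described _ (there (∈-downFrom⁺ x<z))
      agree-at (at-z refl) _ _ _ = value-z
      agree-at (at-c refl) _ _ _ = J-c
      agree-at (at-e refl) _ _ _ = J-F* (here refl) I⁺-e
      agree-at beyond I⁺x≡F x∈A _ = ⪯F⇒≡F (J⪯solidify x∈A I⁺x≡F)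

      agrees-off-T* : ∀ {x} → AtomOf x A → I⁺ x ≢ T* → J x ≡ M x
      agrees-off-T* {x} = agree-at (position x) refl

    minimal-if-solid : (∀ {x} → x < z → I x ≢ T*) → ∀ J → IsModel J A → ¬ (J ≺[ A ] M)
    minimal-if-solid I-solid J J⊨A (J⪯M , x , x∈A , Jx≢Mx) =
      Jx≢Mx (Below.agrees-off-T* J (isModel-++ʳ Q testProgram J⊨A) J⪯M x∈A I⁺x≢T*)
      where
      I⁺x≢T* : I⁺ x ≢ T*
      I⁺x≢T* I⁺x≡T* = I-solid (T*-below I⁺x≡T*) (trans (sym (I⁺-below (T*-below I⁺x≡T*))) I⁺x≡T*)

    -- If one T*-atom rises to T, the rules a ⇐ b raise all of them and J = M; otherwise J only
    -- lowers T*-atoms of I, and then the rule r that solidification repairs still fails in J.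
    minimal-if-rule-repaired : ∀ {r} → r ∈ Q → ⟦ ruleFormula r ⟧ I ≢ T → ⟦ ruleFormula r ⟧ (solidifyᴵ I) ≡ T →
                               ∀ J → IsModel J A → ¬ (J ≺[ A ] M)
    minimal-if-rule-repaired {r} r∈Q fails repaired J J⊨A (J⪯M , x , x∈A , Jx≢Mx) with I⁺ x ≟V T*
    ... | no  I⁺x≢T* = Jx≢Mx (agrees-off-T* x∈A I⁺x≢T*)
      where open Below J (isModel-++ʳ Q testProgram J⊨A) J⪯M
    ... | yes I⁺x≡T* with any? (λ b → (I⁺ b ≟V T*) ×-dec (J b ≟V T)) (downFrom z)
    ...   | yes some-raised = Jx≢Mx (trans (all-raised some-raised) (sym (cong solidify I⁺x≡T*)))
      where
      open ModelOfTestProgram J (isModel-++ʳ Q testProgram J⊨A)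
      all-raised : Any (λ b → I⁺ b ≡ T* × J b ≡ T) (downFrom z) → J x ≡ T
      all-raised raised with b , b∈ , I⁺b≡T* , Jb≡T ← find raised =
        impV-T⇒T (subst (λ v → impV (J x) v ≡ T) Jb≡T
          (⇐-satisfied (there (∈-downFrom⁺ (T*-below I⁺x≡T*))) I⁺x≡T* (∈-downFrom⁻ b∈) I⁺b≡T*))
    ...   | no  none-raised = rule-fails-when-lowered r fails repaired lowered (J⊨A r (∈-++⁺ˡ r∈Q))
      where
      open Below J (isModel-++ʳ Q testProgram J⊨A) J⪯M
      lowered : ∀ {a} → AtomOfRule a r → Lowered (I a) (J a)
      lowered {a} a∈r with I a ≟V T*
      ... | yes Ia≡T* = subst (λ v → Lowered v (J a)) (sym Ia≡T*) (T*-Lowered Ja⪯T Ja≢T)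
        where
        a<z : a < z
        a<z = Q<z (lose r∈Q a∈r)
        I⁺a≡T* : I⁺ a ≡ T*
        I⁺a≡T* = trans (I⁺-below a<z) Ia≡T*
        Ja⪯T : J a ⪯V T
        Ja⪯T = J⪯solidify (Any.++⁺ˡ (lose r∈Q a∈r)) I⁺a≡T*
        Ja≢T : J a ≢ T
        Ja≢T Ja≡T = none-raised (lose (∈-downFrom⁺ a<z) (I⁺a≡T* , Ja≡T))
      ... | no  Ia≢T* = subst (Lowered (I a)) (sym Ja≡Ia) same
        where
        a<z : a < z
        a<z = Q<z (lose r∈Q a∈r)
        Ja≡Ia : J a ≡ I a
        Ja≡Ia = trans (agrees-off-T* (Any.++⁺ˡ (lose r∈Q a∈r)) (subst (_≢ T*) (sym (I⁺-below a<z)) Ia≢T*))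
                      (trans (cong solidify (I⁺-below a<z)) (solidify-fixes Ia≢T*))

    -- Otherwise lowering c to T* gives a smaller model: besides the constraints c occurs in no
    -- rule, and the constraints hold as soon as c is T*.
    guard-not-T : ∀ {N} → AnswerSet A N → N c ≢ T
    guard-not-T {N} (_ , N⊨A , _ , N-minimal) Nc≡T = N-minimal J J⊨A (J⪯N , c , c∈A , Jc≢Nc)
      where
      J : Interpretation
      J = update N c T*

      N⊨test : IsModel N testProgram
      N⊨test = isModel-++ʳ Q testProgram N⊨A

      unchanged : ∀ {a} → a ≢ c → J a ≡ N a
      unchanged = update-other N c T*

      J⊨Q : IsModel J Q
      J⊨Q = isModel-local Q (λ a∈Q → sym (unchanged (below-≢c (Q<z a∈Q)))) (isModel-++ˡ Q testProgram N⊨A)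

      J⊨test : IsModel J testProgram
      J⊨test r r∈ with ∈⇒testRule r∈
      ... | fact-z rewrite unchanged z≢c = N⊨test _ r∈
      ... | fact-T a∈ _ rewrite unchanged (described-≢c a∈) = N⊨test _ r∈
      ... | ⇐-T* a∈ _ b<z _ rewrite unchanged (described-≢c a∈) | unchanged (below-≢c b<z) = N⊨test _ r∈
      ... | choice-F* a∈ _ rewrite unchanged (described-≢c a∈) | unchanged z≢c = N⊨test _ r∈
      ... | constraint-F* {a} _ _ rewrite update-same N c T* = constraint-holds-T* (J a)

      J⊨A : IsModel J A
      J⊨A = isModel-++ Q testProgram J⊨Q J⊨test

      J⪯N : J ⪯[ A ] N
      J⪯N x _ = update-⪯ N c (subst (T* ⪯V_) (sym Nc≡T) (inj₁ T*≺T)) x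

      Jc≢Nc : J c ≢ N c
      Jc≢Nc Jc≡Nc with () ← trans (sym (update-same N c T*)) (trans Jc≡Nc Nc≡T)

    F*-persists : ∀ {N} → AnswerSet A N → ∀ {y} → I⁺ y ≡ F* → N y ≡ F*
    F*-persists {N} N∈AS@(_ , N⊨A , N-solid , _) {y} = F*-at (position y) refl
      where
      open ModelOfTestProgram N (isModel-++ʳ Q testProgram N⊨A)
      Nc≢T* : N c ≢ T*
      Nc≢T* = N-solid c c∈A

      N-described : ∀ {a} → a ∈ described → I⁺ a ≡ F* → N a ≡ F*
      N-described a∈ I⁺a≡F* with choice-holds (choice-satisfied a∈ I⁺a≡F*)
      ... | inj₁ Na≡F* = Na≡F*
      ... | inj₂ Na≡T  = ⊥-elim (guard-not-T N∈AS (constraint-holds-T a-constraint Nc≢T*))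
        where
        a-constraint : impV (N c) (minV T (notV (N c))) ≡ T
        a-constraint = subst (λ v → impV (N c) (minV v (notV (N c))) ≡ T) Na≡T (constraint-satisfied a∈ I⁺a≡F*)

      Nc≡F* : N c ≡ F*
      Nc≡F* = constraint-holds-F* e-constraint Nc≢T* (guard-not-T N∈AS)
        where
        e-constraint : impV (N c) (minV F* (notV (N c))) ≡ T
        e-constraint = subst (λ v → impV (N c) (minV v (notV (N c))) ≡ T) (N-described (here refl) I⁺-e)
                             (constraint-satisfied (here refl) I⁺-e)

      F*-at : ∀ {y v} → Position y v → I⁺ y ≡ v → v ≡ F* → N y ≡ F*
      F*-at (below y<z) I⁺y≡Iy Iy≡F* = N-described (there (∈-downFrom⁺ y<z)) (trans I⁺y≡Iy Iy≡F*)
      F*-at (at-c refl) _ _ = Nc≡F*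
      F*-at (at-e refl) _ _ = N-described (here refl) I⁺-e
      F*-at (at-z _)    _ ()
      F*-at beyond      _ ()

    M-mostPreferred : IsModel M Q → (∀ J → IsModel J A → ¬ (J ≺[ A ] M)) → MostPreferred A M
    M-mostPreferred M⊨Q M-minimal =
      (M-canonical , isModel-++ Q testProgram M⊨Q M⊨testProgram , M-solid , M-minimal) ,
      λ N N∈AS (_ , _ , _ , Mx≡F* , Nx≢F*) → Nx≢F* (F*-persists N∈AS (solidify-F* Mx≡F*))

ruleAtoms : Rule → List Atom
ruleAtoms r = toList (head r) ++ pos r ++ neg r

atomBound : LPOD → ℕ
atomBound P = suc (max 0 (concatMap ruleAtoms P))

atomOf⇒<atomBound : ∀ P {a} → AtomOf a P → a < atomBound P
atomOf⇒<atomBound P a∈P =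
  s≤s (All.lookup (xs≤max 0 (concatMap ruleAtoms P)) (∈-concatMap⁺ ruleAtoms (Any.map ∈ruleAtoms a∈P)))
  where
  ∈ruleAtoms : ∀ {a r} → AtomOfRule a r → a ∈ ruleAtoms r
  ∈ruleAtoms (inj₁ a∈)                = ∈-++⁺ˡ a∈
  ∈ruleAtoms {r = r} (inj₂ (inj₁ a∈)) = ∈-++⁺ʳ (toList (head r)) (∈-++⁺ˡ a∈)
  ∈ruleAtoms {r = r} (inj₂ (inj₂ a∈)) = ∈-++⁺ʳ (toList (head r)) (∈-++⁺ʳ (pos r) a∈)

module _ {P₁ P₂ : LPOD} (P₁≅P₂ : StronglyEquivalentMP P₁ P₂) where
  private
    z : ℕ
    z = atomBound (P₁ ++ P₂)

    P₁<z : ∀ {a} → AtomOf a P₁ → a < z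
    P₁<z = atomOf⇒<atomBound (P₁ ++ P₂) ∘ Any.++⁺ˡ

    P₂<z : ∀ {a} → AtomOf a P₂ → a < z
    P₂<z = atomOf⇒<atomBound (P₁ ++ P₂) ∘ Any.++⁺ʳ P₁

  solidified-model-transfer : ∀ I → IsModel I P₁ → IsModel (solidifyᴵ I) P₂
  solidified-model-transfer I I⊨P₁ = isModel-local P₂ (M≡I′ ∘ P₂<z) (isModel-++ˡ P₂ testProgram M⊨P₂++test)
    where
    I′ : Interpretation
    I′ = solidifyᴵ I
    open TestProgram I′ z

    M≡I′ : ∀ {a} → a < z → M a ≡ I′ a
    M≡I′ {a} a<z = trans (cong solidify (I⁺-below a<z)) (solidify-idem (I a))

    M⊨P₁ : IsModel M P₁
    M⊨P₁ = isModel-local P₁ (sym ∘ M≡I′ ∘ P₁<z) (isModel-solidify P₁ I I⊨P₁)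

    M-preferred₁ : MostPreferred (P₁ ++ testProgram) M
    M-preferred₁ = M-mostPreferred M⊨P₁ (minimal-if-solid (λ {x} _ → solidify-≢T* (I x)))
      where open Extension P₁ P₁<z

    M⊨P₂++test : IsModel M (P₂ ++ testProgram)
    M⊨P₂++test = proj₁ (proj₂ (proj₁ (proj₁ (P₁≅P₂ testProgram M) M-preferred₁)))

  model-transfer : ∀ I → IsModel I P₁ → IsModel I P₂
  model-transfer I I⊨P₁ r r∈P₂ with ⟦ ruleFormula r ⟧ I ≟V T
  ... | yes r-holds = r-holds
  ... | no  r-fails = ⊥-elim (M-minimal₁ I⁺ I⁺⊨P₁++test (I⁺⪯M , x , x∈P₁++test , I⁺x≢Mx))
    where
    open TestProgram I z
    I′⊨P₂ : IsModel (solidifyᴵ I) P₂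
    I′⊨P₂ = solidified-model-transfer I I⊨P₁

    M⊨P₂ : IsModel M P₂
    M⊨P₂ = isModel-local P₂ (cong solidify ∘ sym ∘ I⁺-below ∘ P₂<z) I′⊨P₂

    M-preferred₂ : MostPreferred (P₂ ++ testProgram) M
    M-preferred₂ = M-mostPreferred M⊨P₂ (minimal-if-rule-repaired r∈P₂ r-fails (I′⊨P₂ r r∈P₂))
      where open Extension P₂ P₂<z

    M-minimal₁ : ∀ J → IsModel J (P₁ ++ testProgram) → ¬ (J ≺[ P₁ ++ testProgram ] M)
    M-minimal₁ = proj₂ (proj₂ (proj₂ (proj₁ (proj₂ (P₁≅P₂ testProgram M) M-preferred₂))))

    I⁺⊨P₁++test : IsModel I⁺ (P₁ ++ testProgram)
    I⁺⊨P₁++test = isModel-++ P₁ testProgram (isModel-local P₁ (sym ∘ I⁺-below ∘ P₁<z) I⊨P₁) I⁺⊨testProgram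

    I⁺⪯M : I⁺ ⪯[ P₁ ++ testProgram ] M
    I⁺⪯M x _ = ⪯-solidify (I⁺ x)

    T*-head : ∃ λ x → x ∈ toList (head r) × I x ≡ T*
    T*-head = T*-head-of-repaired-rule r I r-fails (I′⊨P₂ r r∈P₂)
    x : Atom
    x = proj₁ T*-head

    I⁺x≡T* : I⁺ x ≡ T*
    I⁺x≡T* = trans (I⁺-below (P₂<z (lose r∈P₂ (inj₁ (proj₁ (proj₂ T*-head)))))) (proj₂ (proj₂ T*-head))

    x∈P₁++test : AtomOf x (P₁ ++ testProgram)
    x∈P₁++test = Any.++⁺ʳ P₁ (testProgram-atom (subst (_≢ F) (sym I⁺x≡T*) λ ()))

    I⁺x≢Mx : I⁺ x ≢ M x
    I⁺x≢Mx I⁺x≡Mx with () ← trans (sym I⁺x≡T*) (trans I⁺x≡Mx (cong solidify I⁺x≡T*))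

StronglyEquivalentMP-sym : ∀ {P₁ P₂} → StronglyEquivalentMP P₁ P₂ → StronglyEquivalentMP P₂ P₁
StronglyEquivalentMP-sym P₁≅P₂ P M = swap (P₁≅P₂ P M)

theorem1 : (P₁ P₂ : LPOD) →
    (StronglyEquivalentMP P₁ P₂ → LogicallyEquivalent P₁ P₂) ×
    (LogicallyEquivalent P₁ P₂ → StronglyEquivalentMP P₁ P₂)
theorem1 P₁ P₂ =
  (λ P₁≅P₂ I → model-transfer P₁≅P₂ I , model-transfer (StronglyEquivalentMP-sym P₁≅P₂) I) ,
  logicallyEquivalent⇒stronglyEquivalent
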